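{- Let $G$ be a connected claw-free graph and let $K$ be a clique of order $k$ in $G$. Then $G-V(K)$ has at most $k+1$ connected components.
   Context: A graph is claw-free if it contains no induced subgraph isomorphic to $K_{1,3}$. $G-V(K)$ denotes the graph obtained from $G$ by deleting the vertices of $K$. -}

module Defs where

open import Data.Nat using (ℕ)
open import Data.Bool using (Bool; true; false; T)
open import Data.Fin using (Fin)
open import Data.Fin.Subset using (Subset; _∈_; _∉_; ∣_∣)
open import Data.List using (List)
open import Data.List.Relation.Unary.All using (All)
open import Data.List.Relation.Unary.AllPairs using (AllPairs)
open import Data.Product using (Σ; _×_; ∃)
open import Relation.Binary.PropositionalEquality using (_≡_; _≢_)
open import Relation.Nullary using (¬_)

record Graph (n : ℕ) : Set where
  field
    adj    : Fin n → Fin n → Bool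
    sym    : ∀ u v → adj u v ≡ adj v u
    irrefl : ∀ v → adj v v ≡ false

open Graph public

Adj : ∀ {n} → Graph n → Fin n → Fin n → Set
Adj G u v = T (adj G u v)

data ReachIn {n} (G : Graph n) (S : Subset n) : Fin n → Fin n → Set where
  here : ∀ {u} → u ∈ S → ReachIn G S u u
  step : ∀ {u w v} → u ∈ S → Adj G u w → ReachIn G S w v → ReachIn G S u v

full : ∀ {n} → Subset n
full = Data.Fin.Subset.⊤
  where open import Data.Fin.Subset using (⊤)

Connected : ∀ {n} → Graph n → Set
Connected {n} G = ∀ (u v : Fin n) → ReachIn G full u v

HasInducedClaw : ∀ {n} → Graph n → Set
HasInducedClaw {n} G =
  Σ (Fin n) λ c → Σ (Fin n) λ x → Σ (Fin n) λ y → Σ (Fin n) λ z →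
    Adj G c x × Adj G c y × Adj G c z ×
    x ≢ y × x ≢ z × y ≢ z ×
    ¬ Adj G x y × ¬ Adj G x z × ¬ Adj G y z

ClawFree : ∀ {n} → Graph n → Set
ClawFree G = ¬ HasInducedClaw G

IsClique : ∀ {n} → Graph n → Subset n → Set
IsClique {n} G K = ∀ (u v : Fin n) → u ∈ K → v ∈ K → u ≢ v → Adj G u v

-- complement of K, i.e. the vertex set of G - V(K)
minus : ∀ {n} → Subset n → Subset n
minus K = Data.Fin.Subset.∁ K
  where open import Data.Fin.Subset using (∁)

-- "G - V(K) has at most m components": any list of vertices of G - V(K)
-- lying in pairwise distinct components of G - V(K) has length ≤ m.
AtMostComponents : ∀ {n} → Graph n → Subset n → ℕ → Set
AtMostComponents {n} G K m =
  ∀ (vs : List (Fin n)) →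
    All (λ v → v ∉ K) vs →
    AllPairs (λ u v → ¬ ReachIn G (minus K) u v) vs →
    Data.List.length vs Data.Nat.≤ m

{-# OPTIONS --safe #-}
-- For K ≠ ∅, connectivity joins every component C of G − K to K by an edge w_C x_C.
-- Claw-freeness makes C ↦ x_C injective up to a single collision: three components
-- sharing x give a claw at x; and if C ≠ D share x, every other y ∈ K is adjacent to
-- w_C or w_D (else x; w_C, w_D, y is a claw), so two further components sharing y
-- give a claw at y.
module Submission where

open import Defs
open import Data.Nat using (ℕ; suc; _≤_; z≤n; s≤s)
open import Data.Nat.Properties using (≤-trans)
open import Data.Fin using (Fin; _≟_)
open import Data.Fin.Subset using (Subset; ∣_∣; _∈_; _∉_; _⊆_; _-_; Nonempty; Empty)
open import Data.Fin.Subset.Properties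
  using (_∈?_; nonempty?; x∈p∧x≢y⇒x∈p-y; x∈p⇒∣p-x∣<∣p∣; x∉p⇒x∈∁p; x∈∁p⇒x∉p)
open import Data.Product using (∃; _×_; _,_; proj₁; proj₂)
open import Data.Sum using (_⊎_; inj₁; inj₂)
open import Data.Empty using (⊥; ⊥-elim)
open import Data.Bool using (T)
open import Data.List using (List; []; _∷_; length; map)
open import Data.List.Properties using (length-map)
open import Data.List.Relation.Unary.All as All using (All; []; _∷_)
open import Data.List.Relation.Unary.All.Properties.Core using (¬Any⇒All¬)
open import Data.List.Relation.Unary.Any using (any?)
open import Data.List.Relation.Unary.AllPairs as AllPairs using (AllPairs; []; _∷_)
import Data.List.Relation.Unary.AllPairs.Properties as AllPairsₚ
open import Data.List.Membership.Propositional using (find) renaming (_∈_ to _∈ₗ_)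
open import Data.List.Relation.Unary.Any using (here; there)
open import Function using (_∘_; _on_)
open import Relation.Binary.Core using (Rel)
open import Relation.Binary.Definitions using (Symmetric)
open import Relation.Binary.PropositionalEquality as ≡ using (_≡_; _≢_; refl; subst; cong)
open import Relation.Nullary using (¬_; yes; no)
open import Relation.Nullary.Decidable using (T?)

module _ {a ℓ₁ ℓ₂} {A : Set a} {R : Rel A ℓ₁} {S : Rel A ℓ₂} where

  AllPairs-map-∈ : ∀ {xs} → (∀ {x y} → x ∈ₗ xs → y ∈ₗ xs → R x y → S x y) →
    AllPairs R xs → AllPairs S xs
  AllPairs-map-∈ f [] = []
  AllPairs-map-∈ f (Rx ∷ Rxs) =
    All.tabulate (λ y∈ → f (here refl) (there y∈) (All.lookup Rx y∈)) ∷
    AllPairs-map-∈ (λ x∈ y∈ → f (there x∈) (there y∈)) Rxs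

module _ {a ℓ} {A : Set a} {R : Rel A ℓ} (R-sym : Symmetric R) where

  AllPairs-lookup : ∀ {xs x y} → AllPairs R xs → x ∈ₗ xs → y ∈ₗ xs → x ≡ y ⊎ R x y
  AllPairs-lookup (_ ∷ _)    (here refl) (here refl) = inj₁ refl
  AllPairs-lookup (Rx ∷ _)   (here refl) (there y∈)  = inj₂ (All.lookup Rx y∈)
  AllPairs-lookup (Ry ∷ _)   (there x∈)  (here refl) = inj₂ (R-sym (All.lookup Ry x∈))
  AllPairs-lookup (_ ∷ Rxs)  (there x∈)  (there y∈)  = AllPairs-lookup Rxs x∈ y∈

map-proj₁-toList : ∀ {a ℓ} {A : Set a} {P : A → Set ℓ} {xs : List A} (pxs : All P xs) →
  map proj₁ (All.toList pxs) ≡ xs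
map-proj₁-toList []         = refl
map-proj₁-toList (_ ∷ pxs) = cong (_ ∷_) (map-proj₁-toList pxs)

module _ {ℓ} {A : Set ℓ} {n} (f : A → Fin n) where

  All∈-remove : ∀ {xs p x} → All (λ b → f b ∈ p) xs → All (λ b → x ≢ f b) xs →
    All (λ b → f b ∈ p - x) xs
  All∈-remove ∈p ≢x =
    All.zipWith (λ (fb∈p , x≢fb) → x∈p∧x≢y⇒x∈p-y fb∈p (x≢fb ∘ ≡.sym)) (∈p , ≢x)

  length≤∣p∣ : ∀ {xs p} → AllPairs (_≢_ on f) xs → All (λ b → f b ∈ p) xs →
    length xs ≤ ∣ p ∣
  length≤∣p∣ [] [] = z≤n
  length≤∣p∣ (fa≢ ∷ injective) (fa∈p ∷ ∈p) =
    ≤-trans (s≤s (length≤∣p∣ injective (All∈-remove ∈p fa≢)))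
            (x∈p⇒∣p-x∣<∣p∣ fa∈p)

module _ {ℓ₁ ℓ₂} {A : Set ℓ₁} {R : Rel A ℓ₂} (R-sym : Symmetric R) {n} (f : A → Fin n)
  (no-triple : ∀ {a b c} → R a b → R a c → R b c → f a ≡ f b → f a ≡ f c → ⊥)
  (no-double : ∀ {a b c d} → R a b → R a c → R a d → R b c → R b d → R c d →
               f a ≡ f b → f c ≡ f d → ⊥)
  where

  injective-beyond-collision : ∀ {a a₁ xs} → All (R a) xs → AllPairs R xs →
    a₁ ∈ₗ xs → f a ≡ f a₁ → AllPairs (_≢_ on f) xs
  injective-beyond-collision Ra Rxs a₁∈ fa≡fa₁ = AllPairs-map-∈ no-collision Rxs
    where
    no-collision : ∀ {x y} → x ∈ₗ _ → y ∈ₗ _ → R x y → f x ≢ f y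
    no-collision x∈ y∈ Rxy fx≡fy
      with AllPairs-lookup R-sym Rxs a₁∈ x∈ | AllPairs-lookup R-sym Rxs a₁∈ y∈
    ... | inj₁ refl | _ = no-triple (All.lookup Ra x∈) (All.lookup Ra y∈) Rxy
                            fa≡fa₁ (≡.trans fa≡fa₁ fx≡fy)
    ... | inj₂ _ | inj₁ refl = no-triple (All.lookup Ra x∈) (All.lookup Ra y∈) Rxy
                                 (≡.trans fa≡fa₁ (≡.sym fx≡fy)) fa≡fa₁
    ... | inj₂ Ra₁x | inj₂ Ra₁y =
      no-double (All.lookup Ra a₁∈) (All.lookup Ra x∈) (All.lookup Ra y∈) Ra₁x Ra₁y Rxy
        fa≡fa₁ fx≡fy

  length≤1+∣p∣ : ∀ {xs p} → AllPairs R xs → All (λ b → f b ∈ p) xs →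
    length xs ≤ suc ∣ p ∣
  length≤1+∣p∣ [] [] = z≤n
  length≤1+∣p∣ {a ∷ xs} (Ra ∷ Rxs) (fa∈p ∷ ∈p) with any? (λ b → f a ≟ f b) xs
  ... | yes collision =
    let a₁ , a₁∈ , fa≡fa₁ = find collision
    in s≤s (length≤∣p∣ f (injective-beyond-collision Ra Rxs a₁∈ fa≡fa₁) ∈p)
  ... | no no-collision =
    s≤s (≤-trans (length≤1+∣p∣ Rxs (All∈-remove f ∈p (¬Any⇒All¬ xs no-collision)))
                 (x∈p⇒∣p-x∣<∣p∣ fa∈p))

module _ {n} (G : Graph n) where

  Adj-sym : ∀ {u v} → Adj G u v → Adj G v u
  Adj-sym {u} {v} = subst T (Graph.sym G u v)

  Independent : Fin n → Fin n → Set
  Independent u v = u ≢ v × ¬ Adj G u v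

  induced-claw : ∀ {c x y z} → Adj G c x → Adj G c y → Adj G c z →
    Independent x y → Independent x z → Independent y z → HasInducedClaw G
  induced-claw {c} {x} {y} {z} cx cy cz (x≢y , x≁y) (x≢z , x≁z) (y≢z , y≁z) =
    c , x , y , z , cx , cy , cz , x≢y , x≢z , y≢z , x≁y , x≁z , y≁z

  module _ {S : Subset n} where

    reach-source : ∀ {u v} → ReachIn G S u v → u ∈ S
    reach-source (here u∈S)     = u∈S
    reach-source (step u∈S _ _) = u∈S

    reach-trans : ∀ {u v w} → ReachIn G S u v → ReachIn G S v w → ReachIn G S u w
    reach-trans (here _)          vw = vw
    reach-trans (step u∈S u~ uv) vw = step u∈S u~ (reach-trans uv vw)

    reach-sym : ∀ {u v} → ReachIn G S u v → ReachIn G S v u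
    reach-sym (here u∈S)         = here u∈S
    reach-sym (step u∈S u~w wv) =
      reach-trans (reach-sym wv) (step (reach-source wv) (Adj-sym u~w) (here u∈S))

    reach-target : ∀ {u v} → ReachIn G S u v → v ∈ S
    reach-target = reach-source ∘ reach-sym

  reach-mono : ∀ {S S′ u v} → S ⊆ S′ → ReachIn G S u v → ReachIn G S′ u v
  reach-mono S⊆S′ (here u∈S)        = here (S⊆S′ u∈S)
  reach-mono S⊆S′ (step u∈S u~w wv) = step (S⊆S′ u∈S) u~w (reach-mono S⊆S′ wv)

module _ {n} (G : Graph n) (K : Subset n) where

  record Attachment (v : Fin n) : Set where
    field
      exit       : Fin n
      v⇝exit     : ReachIn G (minus K) v exit
      entry      : Fin n
      entry∈K    : entry ∈ K
      entry~exit : Adj G entry exit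

  open Attachment

  reroot : ∀ {u v} → ReachIn G (minus K) u v → Attachment v → Attachment u
  reroot u⇝v α = record
    { exit = exit α ; v⇝exit = reach-trans G u⇝v (v⇝exit α)
    ; entry = entry α ; entry∈K = entry∈K α ; entry~exit = entry~exit α }

  attachment : ∀ {v t} → ReachIn G full v t → v ∉ K → t ∈ K → Attachment v
  attachment (here _) v∉K v∈K = ⊥-elim (v∉K v∈K)
  attachment {v} (step {w = w} _ v~w w⇝t) v∉K t∈K with w ∈? K
  ... | yes w∈K = record
    { exit = v ; v⇝exit = here (x∉p⇒x∈∁p v∉K)
    ; entry = w ; entry∈K = w∈K ; entry~exit = Adj-sym G v~w }
  ... | no w∉K = reroot (step (x∉p⇒x∈∁p v∉K) v~w (here (x∉p⇒x∈∁p w∉K)))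
                        (attachment w⇝t w∉K t∈K)

  entry~exit-of : ∀ {v x} (α : Attachment v) → entry α ≡ x → Adj G x (exit α)
  entry~exit-of α refl = entry~exit α

  exit-independent-of-K : ∀ {v y} (α : Attachment v) → y ∈ K → ¬ Adj G y (exit α) →
    Independent G (exit α) y
  exit-independent-of-K α y∈K y≁exit =
    (λ exit≡y → x∈∁p⇒x∉p (reach-target G (v⇝exit α)) (subst (_∈ K) (≡.sym exit≡y) y∈K)) ,
    y≁exit ∘ Adj-sym G

  -- A record, not a function, so that α and β are inferable from a proof.
  record Separated (α β : ∃ Attachment) : Set where
    constructor separated
    field different-components : ¬ ReachIn G (minus K) (proj₁ α) (proj₁ β)

  separated-sym : Symmetric Separated
  separated-sym (separated ¬u⇝v) = separated (¬u⇝v ∘ reach-sym G)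

  exits-independent : ∀ {u v} {α : Attachment u} {β : Attachment v} →
    Separated (u , α) (v , β) → Independent G (exit α) (exit β)
  exits-independent {α = α} {β} (separated ¬u⇝v) =
    (λ exits≡ → ¬u⇝v (reach-trans G (v⇝exit α)
                       (subst (λ w → ReachIn G _ w _) (≡.sym exits≡) (reach-sym G (v⇝exit β))))) ,
    (λ exits~ → ¬u⇝v (reach-trans G (v⇝exit α)
                       (step (reach-target G (v⇝exit α)) exits~ (reach-sym G (v⇝exit β)))))

  module _ (claw-free : ClawFree G) (clique : IsClique G K) where

    entryOf : ∃ Attachment → Fin n
    entryOf = entry ∘ proj₂

    no-shared-triple : ∀ {α β γ} → Separated α β → Separated α γ → Separated β γ →
      entryOf α ≡ entryOf β → entryOf α ≡ entryOf γ → ⊥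
    no-shared-triple {_ , α} {_ , β} {_ , γ} αβ αγ βγ αβ-entry αγ-entry =
      claw-free (induced-claw G (entry~exit α)
                  (entry~exit-of β (≡.sym αβ-entry)) (entry~exit-of γ (≡.sym αγ-entry))
                  (exits-independent αβ) (exits-independent αγ) (exits-independent βγ))

    no-two-shared-pairs : ∀ {α β γ δ} →
      Separated α β → Separated α γ → Separated α δ →
      Separated β γ → Separated β δ → Separated γ δ →
      entryOf α ≡ entryOf β → entryOf γ ≡ entryOf δ → ⊥
    no-two-shared-pairs {_ , α} {_ , β} {_ , γ} {_ , δ} αβ αγ αδ βγ βδ γδ αβ-entry γδ-entry
      with entry γ ≟ entry α
    ... | yes γα-entry =
      no-shared-triple αγ αδ γδ (≡.sym γα-entry) (≡.trans (≡.sym γα-entry) γδ-entry)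
    ... | no γα-entry with T? (adj G (entry γ) (exit α)) | T? (adj G (entry γ) (exit β))
    ...   | yes γ~α | _ =
      claw-free (induced-claw G γ~α (entry~exit γ) (entry~exit-of δ (≡.sym γδ-entry))
                  (exits-independent αγ) (exits-independent αδ) (exits-independent γδ))
    ...   | no _ | yes γ~β =
      claw-free (induced-claw G γ~β (entry~exit γ) (entry~exit-of δ (≡.sym γδ-entry))
                  (exits-independent βγ) (exits-independent βδ) (exits-independent γδ))
    ...   | no γ≁α | no γ≁β =
      claw-free (induced-claw G (entry~exit α) (entry~exit-of β (≡.sym αβ-entry))
                  (clique _ _ (entry∈K α) (entry∈K γ) (γα-entry ∘ ≡.sym))
                  (exits-independent αβ)
                  (exit-independent-of-K α (entry∈K γ) γ≁α)
                  (exit-independent-of-K β (entry∈K γ) γ≁β))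

    at-most-1+∣K∣-components : Connected G → Nonempty K → AtMostComponents G K (suc ∣ K ∣)
    at-most-1+∣K∣-components connected (t , t∈K) vs vs∉K vs-separated =
      subst (_≤ suc ∣ K ∣) length-attached
        (length≤1+∣p∣ separated-sym entryOf no-shared-triple no-two-shared-pairs
          attached-separated (All.universal (entry∈K ∘ proj₂) attached))
      where
      attached : List (∃ Attachment)
      attached = All.toList (All.map (λ v∉K → attachment (connected _ t) v∉K t∈K) vs∉K)

      roots : map proj₁ attached ≡ vs
      roots = map-proj₁-toList _

      length-attached : length attached ≡ length vs
      length-attached = ≡.trans (≡.sym (length-map proj₁ attached)) (cong length roots)

      attached-separated : AllPairs Separated attached
      attached-separated =
        AllPairs.map separated (AllPairsₚ.map⁻ (subst (AllPairs _) (≡.sym roots) vs-separated))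

at-most-1-component : ∀ {n} (G : Graph n) (K : Subset n) → Connected G → Empty K →
  AtMostComponents G K 1
at-most-1-component G K connected K-empty []          _ _ = z≤n
at-most-1-component G K connected K-empty (_ ∷ [])    _ _ = s≤s z≤n
at-most-1-component G K connected K-empty (u ∷ v ∷ _) _ ((¬u⇝v ∷ _) ∷ _) =
  ⊥-elim (¬u⇝v (reach-mono G (λ {x} _ → x∉p⇒x∈∁p (K-empty ∘ (x ,_))) (connected u v)))

lemma4p9 : ∀ {n} (G : Graph n) → Connected G → ClawFree G →
    (K : Subset n) (k : ℕ) → IsClique G K → ∣ K ∣ ≡ k →
    AtMostComponents G K (suc k)
lemma4p9 G connected claw-free K k clique refl with nonempty? K
... | yes K-nonempty = at-most-1+∣K∣-components G K claw-free clique connected K-nonempty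
... | no K-empty = λ vs vs∉K vs-separated →
  ≤-trans (at-most-1-component G K connected K-empty vs vs∉K vs-separated) (s≤s z≤n)
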